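{- Let $B$ be a bidirected graph, $\mathcal X,\mathcal Y$ sets of signed vertices of $B$, and let $\hat B$, $x$, $y$ be constructed from $B,\mathcal X,\mathcal Y$ as described in the context. If there is a set $\hat S\subseteq E(\hat B)$ of size at most $k$ such that $\hat B-\hat S$ contains no $x$--$y$ path, then there is a set $S\subseteq V(B)$ of size at most $k$ such that $B-S$ contains no $\mathcal X$--$\mathcal Y$ path.
   Context: A bidirected graph $B=(G,\sigma)$ consists of an undirected graph $G$ without loops (no two distinct edges have the same endvertices and the same signs at them) with a signing $\sigma$ assigning to every pair $(u,e)$, $u$ an endvertex of edge $e$, a sign $\sigma(u,e)\in\{+,-\}$. A signed vertex is a pair $(v,\alpha)$; $V(\mathcal X)$ is the set of vertices appearing in $\mathcal X$. A walk is a sequence $v_0\vec e_1v_1\dots\vec e_\ell v_\ell$, $\vec e_j$ the edge $e_j$ oriented from $v_{j-1}$ to $v_j$, with $\sigma(v_i,e_i)\neq\sigma(v_i,e_{i+1})$ for $1\le i\le\ell-1$; trivial if $\ell=0$. A nontrivial walk starts in $(v_0,\sigma(v_0,e_1))$ and ends in $(v_\ell,\sigma(v_\ell,e_\ell))$; $v_1,\dots,v_{\ell-1}$ are internal. A path is a walk with distinct vertices; an $x$--$y$ path is a nontrivial path from vertex $x$ to vertex $y$. A trivial walk $v$ is an $\mathcal X$--$\mathcal Y$ walk if there is $\alpha$ with $(v,\alpha)\in\mathcal X$, $(v,-\alpha)\in\mathcal Y$; a nontrivial walk is an $\mathcal X$--$\mathcal Y$ walk if it starts in a signed vertex of $\mathcal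 X$, ends in one of $\mathcal Y$, has no internal vertex in $V(\mathcal X)\cup V(\mathcal Y)$, and neither its start- nor endvertex forms a trivial $\mathcal X$--$\mathcal Y$ walk; an $\mathcal X$--$\mathcal Y$ path is such a walk that is a path. Construction of $\hat B=(\hat G,\hat\sigma)$: for each $v\in V(B)$ take two vertices $v^+,v^-$ joined by an edge with sign $+$ at $v^-$ and $-$ at $v^+$. Each edge $e$ of $B$ with endvertices $u,v$ yields an edge $\hat e$ between $u^{\sigma(u,e)}$ and $v^{\sigma(v,e)}$ with $\hat\sigma(u^{\sigma(u,e)},\hat e)=\sigma(u,e)$ and $\hat\sigma(v^{\sigma(v,e)},\hat e)=\sigma(v,e)$. Add two new vertices $x,y$; for every $(v,-\alpha)\in\mathcal X$ add an edge between $x$ and $v^\alpha$ with sign $\alpha$ at $v^\alpha$ and $-$ at $x$; for every $(v,-\beta)\in\mathcal Y$ add an edge between $y$ and $v^\beta$ with sign $\beta$ at $v^\beta$ and $-$ at $y$. -}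

module Defs where

open import Data.Nat using (ℕ; zero; suc)
open import Data.Fin using (Fin; zero; suc; inject₁; fromℕ)
open import Data.Bool using (Bool; true; false; T)
open import Data.Product using (Σ; ∃; _×_; _,_)
open import Data.Sum using (_⊎_)
open import Data.List using (List)
open import Data.List.Membership.Propositional using (_∈_; _∉_)
open import Relation.Binary.PropositionalEquality using (_≡_; _≢_)
open import Relation.Nullary using (¬_)

data Sign : Set where
  plus minus : Sign

neg : Sign → Sign
neg plus  = minus
neg minus = plus

-- Bidirected graph structure on a vertex type V and edge type E.
-- Every edge e has two endvertices end₁ e, end₂ e and signs sg₁ e, sg₂ e
-- (the sign sigma(end_i e, e) at the respective end).

record BiGraph (V E : Set) : Set where
  field
    end₁ end₂ : E → V
    sg₁  sg₂  : E → Sign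
open BiGraph public

record IsBidirected {V E : Set} (G : BiGraph V E) : Set where
  field
    noLoop : ∀ e → end₁ G e ≢ end₂ G e
    simple : ∀ e f → end₁ G e ≡ end₁ G f → end₂ G e ≡ end₂ G f
               → sg₁ G e ≡ sg₁ G f → sg₂ G e ≡ sg₂ G f → e ≡ f
    simple' : ∀ e f → end₁ G e ≡ end₂ G f → end₂ G e ≡ end₁ G f
               → sg₁ G e ≡ sg₂ G f → sg₂ G e ≡ sg₁ G f → e ≡ f

-- Oriented edges: (e , false) runs from end₁ to end₂, (e , true) reversed.

module _ {V E : Set} (G : BiGraph V E) where

  tailV : E → Bool → V
  tailV e false = end₁ G e
  tailV e true  = end₂ G e

  headV : E → Bool → V
  headV e false = end₂ G e
  headV e true  = end₁ G e

  tailS : E → Bool → Sign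
  tailS e false = sg₁ G e
  tailS e true  = sg₂ G e

  headS : E → Bool → Sign
  headS e false = sg₂ G e
  headS e true  = sg₁ G e

  -- A nontrivial walk v₀ e₁ v₁ … e_ℓ v_ℓ with ℓ = suc l.
  -- Vertices are indexed 0 … suc l, edges 0 … l (edge i goes from vertex i
  -- to vertex i+1).
  record NTWalk : Set where
    field
      l      : ℕ
      vert   : Fin (suc (suc l)) → V
      edge   : Fin (suc l) → E
      dir    : Fin (suc l) → Bool
      tailOK : ∀ i → tailV (edge i) (dir i) ≡ vert (inject₁ i)
      headOK : ∀ i → headV (edge i) (dir i) ≡ vert (suc i)
      alt    : ∀ (i : Fin l) →
               headS (edge (inject₁ i)) (dir (inject₁ i)) ≢ tailS (edge (suc i)) (dir (suc i))

  open NTWalk public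

  IsPath : NTWalk → Set
  IsPath W = ∀ i j → vert W i ≡ vert W j → i ≡ j

  startV : NTWalk → V
  startV W = vert W zero

  endV : NTWalk → V
  endV W = vert W (fromℕ (suc (l W)))

  startS : NTWalk → Sign
  startS W = tailS (edge W zero) (dir W zero)

  endS : NTWalk → Sign
  endS W = headS (edge W (fromℕ (l W))) (dir W (fromℕ (l W)))

  internal : (W : NTWalk) → Fin (l W) → V
  internal W i = vert W (suc (inject₁ i))

module _ {V E : Set} (G : BiGraph V E) (X Y : V → Sign → Bool) where

  inVS : (V → Sign → Bool) → V → Set
  inVS Z v = Σ Sign λ α → T (Z v α)

  TrivXY : V → Set
  TrivXY v = Σ Sign λ α → T (X v α) × T (Y v (neg α))

  IsXYWalk : NTWalk G → Set
  IsXYWalk W =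
      T (X (startV G W) (startS G W))
    × T (Y (endV G W) (endS G W))
    × (∀ i → ¬ inVS X (internal G W i) × ¬ inVS Y (internal G W i))
    × ¬ TrivXY (startV G W)
    × ¬ TrivXY (endV G W)

  HasXYPathAvoiding : List V → Set
  HasXYPathAvoiding S =
      (Σ V λ v → TrivXY v × v ∉ S)
    ⊎ (Σ (NTWalk G) λ W → IsPath G W × IsXYWalk W × (∀ i → vert W i ∉ S))

module _ {n m : ℕ} (B : BiGraph (Fin n) (Fin m)) (X Y : Fin n → Sign → Bool) where

  data V̂ : Set where
    vx vy : V̂
    vin   : Fin n → Sign → V̂

  data Ê : Set where
    inner : Fin n → Ê
    orig  : Fin m → Ê
    xE    : (v : Fin n) (α : Sign) → T (X v (neg α)) → Ê
    yE    : (v : Fin n) (β : Sign) → T (Y v (neg β)) → Ê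

  Bhat : BiGraph V̂ Ê
  end₁ Bhat (inner v)    = vin v minus
  end₁ Bhat (orig e)     = vin (end₁ B e) (sg₁ B e)
  end₁ Bhat (xE v α _)   = vx
  end₁ Bhat (yE v β _)   = vy
  end₂ Bhat (inner v)    = vin v plus
  end₂ Bhat (orig e)     = vin (end₂ B e) (sg₂ B e)
  end₂ Bhat (xE v α _)   = vin v α
  end₂ Bhat (yE v β _)   = vin v β
  sg₁ Bhat (inner v)     = plus
  sg₁ Bhat (orig e)      = sg₁ B e
  sg₁ Bhat (xE v α _)    = minus
  sg₁ Bhat (yE v β _)    = minus
  sg₂ Bhat (inner v)     = minus
  sg₂ Bhat (orig e)      = sg₂ B e
  sg₂ Bhat (xE v α _)    = α
  sg₂ Bhat (yE v β _)    = β

  HasXYHatPathAvoiding : List Ê → Set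
  HasXYHatPathAvoiding Ŝ =
    Σ (NTWalk Bhat) λ W → IsPath Bhat W
      × startV Bhat W ≡ vx × endV Bhat W ≡ vy
      × (∀ i → edge W i ∉ Ŝ)

-- Charge every edge of B̂ to a vertex of B: an edge v⁻v⁺, x v^α or y v^β to v, and an edge ê to
-- an endvertex of e.  Every edge of B̂ is incident with a copy v^α of the vertex it is charged to,
-- and S is the set of charges of the edges in Ŝ.  Now an X–Y path v₀ e₁ v₁ … e_ℓ v_ℓ of B − S,
-- starting in (v₀, s) and ending in (v_ℓ, t), lifts to the x–y path
--   x, v₀^{-s}, v₀^{s}, v₁^{t₁}, v₁^{-t₁}, …, v_ℓ^{t}, v_ℓ^{-t}, y
-- of B̂, where t_i is the sign of e_i at v_i; the alternation of signs along the path is exactly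
-- what makes consecutive edges of the lift meet with opposite signs.  Its vertices are distinct
-- since each v_i contributes its two copies once, and its edges avoid Ŝ since they only touch
-- copies of the v_i.  A trivial X–Y walk v lifts to x, v^{-α}, v^{α}, y in the same way.
module Submission where

open import Defs
open import Data.Nat using (ℕ; zero; suc; _≤_)
open import Data.Fin using (Fin; zero; suc; inject₁; fromℕ)
open import Data.Fin.Properties using (suc-injective)
open import Data.Bool using (Bool; true; false; T)
open import Data.Product using (Σ; ∃₂; _×_; _,_)
open import Data.Empty using (⊥-elim)
open import Data.Sum using (_⊎_; inj₁; inj₂)
open import Data.List using (List; length; map)
open import Data.List.Properties using (length-map)
open import Data.List.Membership.Propositional using (_∉_)
open import Data.List.Membership.Propositional.Properties using (∈-map⁺)
open import Function using (_∘_)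
open import Function.Definitions using (Injective)
open import Relation.Binary.PropositionalEquality
  using (_≡_; _≢_; refl; sym; trans; cong; subst)
open import Relation.Nullary using (¬_)

neg-involutive : ∀ a → neg (neg a) ≡ a
neg-involutive plus  = refl
neg-involutive minus = refl

≢neg : ∀ a → a ≢ neg a
≢neg plus  ()
≢neg minus ()

neg-≢ : ∀ a → neg a ≢ a
neg-≢ a = ≢neg a ∘ sym

≢⇒≡neg : ∀ {a b} → a ≢ b → b ≡ neg a
≢⇒≡neg {plus}  {plus}  a≢b = ⊥-elim (a≢b refl)
≢⇒≡neg {plus}  {minus} _   = refl
≢⇒≡neg {minus} {plus}  _   = refl
≢⇒≡neg {minus} {minus} a≢b = ⊥-elim (a≢b refl)

module Walks {V E : Set} (G : BiGraph V E) where

  -- Walk u a w: a nontrivial walk from u to w whose first edge leaves u with sign a.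
  data Walk : V → Sign → V → Set where
    single : ∀ {u a w} e d → tailV G e d ≡ u → tailS G e d ≡ a → headV G e d ≡ w
           → Walk u a w
    step   : ∀ {u a v s w} e d → tailV G e d ≡ u → tailS G e d ≡ a → headV G e d ≡ v
           → headS G e d ≢ s → Walk v s w → Walk u a w

  size : ∀ {u a w} → Walk u a w → ℕ
  size (single _ _ _ _ _)     = zero
  size (step _ _ _ _ _ _ p) = suc (size p)

  vertexAt : ∀ {u a w} (p : Walk u a w) → Fin (suc (suc (size p))) → V
  vertexAt (single {u} _ _ _ _ _)     zero       = u
  vertexAt (single {w = w} _ _ _ _ _) (suc zero) = w
  vertexAt (step {u} _ _ _ _ _ _ _)   zero       = u
  vertexAt (step _ _ _ _ _ _ p)       (suc j)    = vertexAt p j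

  edgeAt : ∀ {u a w} (p : Walk u a w) → Fin (suc (size p)) → E
  edgeAt (single e _ _ _ _)   zero    = e
  edgeAt (step e _ _ _ _ _ _) zero    = e
  edgeAt (step _ _ _ _ _ _ p) (suc i) = edgeAt p i

  dirAt : ∀ {u a w} (p : Walk u a w) → Fin (suc (size p)) → Bool
  dirAt (single _ d _ _ _)   zero    = d
  dirAt (step _ d _ _ _ _ _) zero    = d
  dirAt (step _ _ _ _ _ _ p) (suc i) = dirAt p i

  vertexAt-zero : ∀ {u a w} (p : Walk u a w) → vertexAt p zero ≡ u
  vertexAt-zero (single _ _ _ _ _)   = refl
  vertexAt-zero (step _ _ _ _ _ _ _) = refl

  vertexAt-last : ∀ {u a w} (p : Walk u a w) → vertexAt p (fromℕ (suc (size p))) ≡ w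
  vertexAt-last (single _ _ _ _ _)   = refl
  vertexAt-last (step _ _ _ _ _ _ p) = vertexAt-last p

  startSign-zero : ∀ {u a w} (p : Walk u a w) → tailS G (edgeAt p zero) (dirAt p zero) ≡ a
  startSign-zero (single _ _ _ a≡ _)   = a≡
  startSign-zero (step _ _ _ a≡ _ _ _) = a≡

  tailV-edgeAt : ∀ {u a w} (p : Walk u a w) i
               → tailV G (edgeAt p i) (dirAt p i) ≡ vertexAt p (inject₁ i)
  tailV-edgeAt (single _ _ u≡ _ _)   zero    = u≡
  tailV-edgeAt (step _ _ u≡ _ _ _ _) zero    = u≡
  tailV-edgeAt (step _ _ _ _ _ _ p)  (suc i) = tailV-edgeAt p i

  headV-edgeAt : ∀ {u a w} (p : Walk u a w) i
               → headV G (edgeAt p i) (dirAt p i) ≡ vertexAt p (suc i)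
  headV-edgeAt (single _ _ _ _ w≡)   zero    = w≡
  headV-edgeAt (step _ _ _ _ v≡ _ p) zero    = trans v≡ (sym (vertexAt-zero p))
  headV-edgeAt (step _ _ _ _ _ _ p)  (suc i) = headV-edgeAt p i

  alternates : ∀ {u a w} (p : Walk u a w) (i : Fin (size p))
             → headS G (edgeAt p (inject₁ i)) (dirAt p (inject₁ i))
             ≢ tailS G (edgeAt p (suc i)) (dirAt p (suc i))
  alternates (step _ _ _ _ _ s≢ p) zero    = λ eq → s≢ (trans eq (startSign-zero p))
  alternates (step _ _ _ _ _ _ p)  (suc i) = alternates p i

  toNTWalk : ∀ {u a w} → Walk u a w → NTWalk G
  toNTWalk p = record
    { l = size p ; vert = vertexAt p ; edge = edgeAt p ; dir = dirAt p
    ; tailOK = tailV-edgeAt p ; headOK = headV-edgeAt p ; alt = alternates p }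

  Distinct : ∀ {u a w} → Walk u a w → Set
  Distinct (single {u} {w = w} _ _ _ _ _) = u ≢ w
  Distinct (step {u} _ _ _ _ _ _ p)       = (∀ j → vertexAt p j ≢ u) × Distinct p

  distinct⇒isPath : ∀ {u a w} (p : Walk u a w) → Distinct p → IsPath G (toNTWalk p)
  distinct⇒isPath (single _ _ _ _ _) _    zero       zero       _  = refl
  distinct⇒isPath (single _ _ _ _ _) u≢w  zero       (suc zero) eq = ⊥-elim (u≢w eq)
  distinct⇒isPath (single _ _ _ _ _) u≢w  (suc zero) zero       eq = ⊥-elim (u≢w (sym eq))
  distinct⇒isPath (single _ _ _ _ _) _    (suc zero) (suc zero) _  = refl
  distinct⇒isPath (step _ _ _ _ _ _ p) _         zero    zero    _  = refl
  distinct⇒isPath (step _ _ _ _ _ _ p) (new , _) zero    (suc j) eq = ⊥-elim (new j (sym eq))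
  distinct⇒isPath (step _ _ _ _ _ _ p) (new , _) (suc i) zero    eq = ⊥-elim (new i eq)
  distinct⇒isPath (step _ _ _ _ _ _ p) (_ , ds)  (suc i) (suc j) eq =
    cong suc (distinct⇒isPath p ds i j eq)

module FixedLength {V E : Set} (G : BiGraph V E) where

  -- An NTWalk with its length as an index, so that lifting can recurse on the length.
  record WalkOfLength (L : ℕ) : Set where
    field
      vertex      : Fin (suc (suc L)) → V
      arc         : Fin (suc L) → E
      rev         : Fin (suc L) → Bool
      arc-tail    : ∀ i → tailV G (arc i) (rev i) ≡ vertex (inject₁ i)
      arc-head    : ∀ i → headV G (arc i) (rev i) ≡ vertex (suc i)
      alternating : ∀ (i : Fin L) → headS G (arc (inject₁ i)) (rev (inject₁ i))
                                  ≢ tailS G (arc (suc i)) (rev (suc i))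
  open WalkOfLength public

  fromNTWalk : (W : NTWalk G) → WalkOfLength (l W)
  fromNTWalk W = record
    { vertex = vert W ; arc = edge W ; rev = dir W
    ; arc-tail = tailOK W ; arc-head = headOK W ; alternating = alt W }

  dropFirst : ∀ {L} → WalkOfLength (suc L) → WalkOfLength L
  dropFirst W = record
    { vertex = vertex W ∘ suc ; arc = arc W ∘ suc ; rev = rev W ∘ suc
    ; arc-tail = arc-tail W ∘ suc ; arc-head = arc-head W ∘ suc
    ; alternating = alternating W ∘ suc }

  startSign : ∀ {L} → WalkOfLength L → Sign
  startSign W = tailS G (arc W zero) (rev W zero)

  lastVertex : ∀ {L} → WalkOfLength L → V
  lastVertex {L} W = vertex W (fromℕ (suc L))

  endSign : ∀ {L} → WalkOfLength L → Sign
  endSign {L} W = headS G (arc W (fromℕ L)) (rev W (fromℕ L))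

  dropFirst-injective : ∀ {L} (W : WalkOfLength (suc L))
                      → Injective _≡_ _≡_ (vertex W) → Injective _≡_ _≡_ (vertex (dropFirst W))
  dropFirst-injective W inj = suc-injective ∘ inj

module Lift {n m : ℕ} (B : BiGraph (Fin n) (Fin m)) (X Y : Fin n → Sign → Bool) where

  B̂ : BiGraph (V̂ B X Y) (Ê B X Y)
  B̂ = Bhat B X Y

  open Walks B̂
  open FixedLength B

  vin-injectiveˡ : ∀ {u v α β} → _≡_ {A = V̂ B X Y} (vin u α) (vin v β) → u ≡ v
  vin-injectiveˡ refl = refl

  vin-injectiveʳ : ∀ {u v α β} → _≡_ {A = V̂ B X Y} (vin u α) (vin v β) → α ≡ β
  vin-injectiveʳ refl = refl

  orig-tailV : ∀ e d → tailV B̂ (orig e) d ≡ vin (tailV B e d) (tailS B e d)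
  orig-tailV e false = refl
  orig-tailV e true  = refl

  orig-tailS : ∀ e d → tailS B̂ (orig e) d ≡ tailS B e d
  orig-tailS e false = refl
  orig-tailS e true  = refl

  orig-headV : ∀ e d → headV B̂ (orig e) d ≡ vin (headV B e d) (headS B e d)
  orig-headV e false = refl
  orig-headV e true  = refl

  orig-headS : ∀ e d → headS B̂ (orig e) d ≡ headS B e d
  orig-headS e false = refl
  orig-headS e true  = refl

  innerDir : Sign → Bool
  innerDir plus  = true
  innerDir minus = false

  inner-tailV : ∀ v t → tailV B̂ (inner v) (innerDir t) ≡ vin v t
  inner-tailV v plus  = refl
  inner-tailV v minus = refl

  inner-tailS : ∀ v t → tailS B̂ (inner v) (innerDir t) ≡ neg t
  inner-tailS v plus  = refl
  inner-tailS v minus = refl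

  inner-headV : ∀ v t → headV B̂ (inner v) (innerDir t) ≡ vin v (neg t)
  inner-headV v plus  = refl
  inner-headV v minus = refl

  inner-headS : ∀ v t → headS B̂ (inner v) (innerDir t) ≡ t
  inner-headS v plus  = refl
  inner-headS v minus = refl

  cross : ∀ v t {s w} → t ≢ s → Walk (vin v s) s w → Walk (vin v t) (neg t) w
  cross v t t≢s =
    step (inner v) (innerDir t) (inner-tailV v t) (inner-tailS v t)
      (trans (inner-headV v t) (cong (vin v) (sym (≢⇒≡neg t≢s))))
      (t≢s ∘ trans (sym (inner-headS v t)))

  viaEdge : ∀ e d {u v w} → tailV B e d ≡ u → headV B e d ≡ v
          → Walk (vin v (headS B e d)) (neg (headS B e d)) w
          → Walk (vin u (tailS B e d)) (tailS B e d) w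
  viaEdge e d u≡ v≡ =
    step (orig e) d (trans (orig-tailV e d) (cong (λ z → vin z _) u≡)) (orig-tailS e d)
      (trans (orig-headV e d) (cong (λ z → vin z _) v≡))
      (≢neg _ ∘ trans (sym (orig-headS e d)))

  fromX : ∀ {v s w} → T (X v s) → Walk (vin v s) s w → Walk vx minus w
  fromX {v} {s} xs p =
    step (xE v (neg s) (subst (T ∘ X v) (sym (neg-involutive s)) xs)) false refl refl refl
      (≢neg (neg s)) (cross v (neg s) (neg-≢ s) p)

  toY : ∀ {v β} → T (Y v (neg β)) → Walk (vin v β) β vy
  toY yβ = single (yE _ _ yβ) true refl refl refl

  lift : ∀ {L} (W : WalkOfLength L) → T (Y (lastVertex W) (endSign W))
       → Walk (vin (vertex W zero) (startSign W)) (startSign W) vy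
  lift {zero} W yt =
    viaEdge (arc W zero) (rev W zero) (arc-tail W zero) (arc-head W zero)
      (cross _ _ (≢neg _) (toY (subst (T ∘ Y _) (sym (neg-involutive _)) yt)))
  lift {suc L} W yt =
    viaEdge (arc W zero) (rev W zero) (arc-tail W zero) (arc-head W zero)
      (cross _ _ (alternating W zero) (lift (dropFirst W) yt))

  Later : ∀ {L} → WalkOfLength L → V̂ B X Y → Set
  Later {L} W z = z ≡ vy ⊎ ∃₂ λ (i : Fin (suc L)) α → z ≡ vin (vertex W (suc i)) α

  lift-later : ∀ {L} (W : WalkOfLength L) yt j → Later W (vertexAt (lift W yt) (suc j))
  lift-later {zero}  W yt zero             = inj₂ (zero , _ , refl)
  lift-later {zero}  W yt (suc zero)       = inj₂ (zero , _ , refl)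
  lift-later {zero}  W yt (suc (suc zero)) = inj₁ refl
  lift-later {suc L} W yt zero             = inj₂ (zero , _ , refl)
  lift-later {suc L} W yt (suc zero)       =
    inj₂ (zero , _ , vertexAt-zero (lift (dropFirst W) yt))
  lift-later {suc L} W yt (suc (suc j)) with lift-later (dropFirst W) yt j
  ... | inj₁ z≡y           = inj₁ z≡y
  ... | inj₂ (i , α , z≡v) = inj₂ (suc i , α , z≡v)

  module _ {L} (W : WalkOfLength L) (inj : Injective _≡_ _≡_ (vertex W)) where

    later-≢-start : ∀ {z α} → Later W z → z ≢ vin (vertex W zero) α
    later-≢-start (inj₁ refl) ()
    later-≢-start (inj₂ (i , β , refl)) eq with inj (vin-injectiveˡ eq)
    ... | ()

    lift-≢-start : ∀ yt {α} j → vertexAt (lift W yt) (suc j) ≢ vin (vertex W zero) α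
    lift-≢-start yt j = later-≢-start (lift-later W yt j)

    lift-≢-otherCopy : ∀ yt {α} → α ≢ startSign W
                     → ∀ j → vertexAt (lift W yt) j ≢ vin (vertex W zero) α
    lift-≢-otherCopy yt α≢s zero eq =
      α≢s (sym (vin-injectiveʳ (trans (sym (vertexAt-zero (lift W yt))) eq)))
    lift-≢-otherCopy yt α≢s (suc j) = lift-≢-start yt j

  lift-distinct : ∀ {L} (W : WalkOfLength L) yt → Injective _≡_ _≡_ (vertex W)
                → Distinct (lift W yt)
  lift-distinct {zero} W yt inj =
    lift-≢-start W inj yt , (λ { zero → neg-≢ _ ∘ vin-injectiveʳ ; (suc zero) () }) , λ ()
  lift-distinct {suc L} W yt inj =
    lift-≢-start W inj yt ,
    lift-≢-otherCopy (dropFirst W) inj′ yt (alternating W zero) ,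
    lift-distinct (dropFirst W) yt inj′
    where inj′ = dropFirst-injective W inj

  later-≢-x : ∀ {L} (W : WalkOfLength L) {z} → Later W z → z ≢ vx
  later-≢-x W (inj₁ refl) ()
  later-≢-x W (inj₂ (_ , _ , refl)) ()

  lift-≢-x : ∀ {L} (W : WalkOfLength L) yt j → vertexAt (lift W yt) j ≢ vx
  lift-≢-x W yt zero eq with trans (sym (vertexAt-zero (lift W yt))) eq
  ... | ()
  lift-≢-x W yt (suc j) = later-≢-x W (lift-later W yt j)

  charge : Ê B X Y → Fin n
  charge (inner v)  = v
  charge (orig e)   = end₁ B e
  charge (xE v _ _) = v
  charge (yE v _ _) = v

  charge-incident : ∀ e d → (Σ Sign λ α → tailV B̂ e d ≡ vin (charge e) α)
                          ⊎ (Σ Sign λ α → headV B̂ e d ≡ vin (charge e) α)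
  charge-incident (inner v)  false = inj₁ (minus , refl)
  charge-incident (inner v)  true  = inj₁ (plus , refl)
  charge-incident (orig e)   false = inj₁ (_ , refl)
  charge-incident (orig e)   true  = inj₂ (_ , refl)
  charge-incident (xE v α _) false = inj₂ (α , refl)
  charge-incident (xE v α _) true  = inj₁ (α , refl)
  charge-incident (yE v β _) false = inj₂ (β , refl)
  charge-incident (yE v β _) true  = inj₁ (β , refl)

  Outside : List (Fin n) → V̂ B X Y → Set
  Outside S z = ∀ {u α} → z ≡ vin u α → u ∉ S

  avoids-charged : (Ŝ : List (Ê B X Y)) (P : NTWalk B̂)
                 → (∀ j → Outside (map charge Ŝ) (vert P j)) → ∀ i → edge P i ∉ Ŝ
  avoids-charged Ŝ P out i e∈Ŝ with charge-incident (edge P i) (dir P i)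
  ... | inj₁ (α , tail≡) = out (inject₁ i) (trans (sym (tailOK P i)) tail≡) (∈-map⁺ charge e∈Ŝ)
  ... | inj₂ (α , head≡) = out (suc i) (trans (sym (headOK P i)) head≡) (∈-map⁺ charge e∈Ŝ)

  later-outside : ∀ {L} (W : WalkOfLength L) {S z} → (∀ i → vertex W i ∉ S)
                → Later W z → Outside S z
  later-outside W avoid (inj₁ refl) ()
  later-outside W {S} avoid (inj₂ (i , _ , refl)) eq =
    subst (_∉ S) (vin-injectiveˡ eq) (avoid (suc i))

  lift-outside : ∀ {L} (W : WalkOfLength L) yt {S} → (∀ i → vertex W i ∉ S)
               → ∀ j → Outside S (vertexAt (lift W yt) j)
  lift-outside W yt {S} avoid zero eq =
    subst (_∉ S) (vin-injectiveˡ (trans (sym (vertexAt-zero (lift W yt))) eq)) (avoid zero)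
  lift-outside W yt avoid (suc j) = later-outside W avoid (lift-later W yt j)

  -- p is the part of the x–y path after x, v^{-s}.
  fromX-path : ∀ {v s} (Ŝ : List (Ê B X Y)) (xs : T (X v s)) (p : Walk (vin v s) s vy)
             → (∀ j → vertexAt p j ≢ vx) → (∀ j → vertexAt p j ≢ vin v (neg s)) → Distinct p
             → v ∉ map charge Ŝ → (∀ j → Outside (map charge Ŝ) (vertexAt p j))
             → HasXYHatPathAvoiding B X Y Ŝ
  fromX-path {v} Ŝ xs p ≢x ≢v⁻ distinct v∉S out =
    toNTWalk P , distinct⇒isPath P distinctP , refl , vertexAt-last P ,
    avoids-charged Ŝ (toNTWalk P) outP
    where
    P = fromX xs p
    distinctP : Distinct P
    distinctP = (λ { zero () ; (suc j) → ≢x j }) , ≢v⁻ , distinct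
    outP : ∀ j → Outside (map charge Ŝ) (vertexAt P j)
    outP zero ()
    outP (suc zero) eq = subst (_∉ map charge Ŝ) (vin-injectiveˡ eq) v∉S
    outP (suc (suc j)) = out j

  liftPath : (Ŝ : List (Ê B X Y))
           → HasXYPathAvoiding B X Y (map charge Ŝ) → HasXYHatPathAvoiding B X Y Ŝ
  liftPath Ŝ (inj₁ (v , (α , xα , y-α) , v∉S)) =
    fromX-path Ŝ xα (toY y-α)
      (λ { zero () ; (suc zero) () })
      (λ { zero → ≢neg α ∘ vin-injectiveʳ ; (suc zero) () })
      (λ ()) v∉S
      (λ { zero eq → subst (_∉ map charge Ŝ) (vin-injectiveˡ eq) v∉S ; (suc zero) () })
  liftPath Ŝ (inj₂ (W , isPath , (xs , yt , _) , avoid)) =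
    fromX-path Ŝ xs (lift W′ yt) (lift-≢-x W′ yt)
      (lift-≢-otherCopy W′ inj yt (neg-≢ _)) (lift-distinct W′ yt inj)
      (avoid zero) (lift-outside W′ yt avoid)
    where
    W′ = fromNTWalk W
    inj : Injective _≡_ _≡_ (vertex W′)
    inj = isPath _ _

lemma6p3 : ∀ {n m : ℕ} (B : BiGraph (Fin n) (Fin m)) → IsBidirected B
    → (X Y : Fin n → Sign → Bool) (k : ℕ)
    → (Ŝ : List (Ê B X Y)) → length Ŝ ≤ k
    → ¬ HasXYHatPathAvoiding B X Y Ŝ
    → Σ (List (Fin n)) λ S → length S ≤ k × ¬ HasXYPathAvoiding B X Y S
lemma6p3 B _ X Y k Ŝ |Ŝ|≤k noHatPath =
  map charge Ŝ , subst (_≤ k) (sym (length-map charge Ŝ)) |Ŝ|≤k , noHatPath ∘ liftPath Ŝ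
  where open Lift B X Y
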